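{- For all $\alpha,\alpha'$ in $\Omega_k=\omega^{\omega^k}$ and $n,n'>1$, $(\pi^{ -1}(\alpha)\,|\,\#^n)\,(R_H\cup R_H^{ -1})^\circledast\,(\pi^{ -1}(\alpha')\,|\,\#^{n'})$ if and only if $H^\alpha(n)=H^{\alpha'}(n')$.
   Context: $H^\alpha$ is the Hardy hierarchy ($H^0(n)=n$, $H^{\alpha+1}(n)=H^\alpha(n+1)$, $H^\lambda(n)=H^{\lambda_n}(n)$, with $(\gamma+\omega^{\alpha+1})_n=\gamma+\omega^\alpha\cdot n$, $(\gamma+\omega^\lambda)_n=\gamma+\omega^{\lambda_n}$). Let $\Sigma_k=\{a_0,\dots,a_{k-1}\}$, $\varphi(a_i)=i$, $\Sigma_{k\#}=\Sigma_k\uplus\{\#\}$, $\beta(b_1\cdots b_n)=\omega^{\varphi(b_1)}+\cdots+\omega^{\varphi(b_n)}$, and for codes $\pi(w)=0$ ($w\in\Sigma_k^\ast$), $\pi(w\#x)=\omega^{\beta(w)}\cdot\pi(x)+\omega^{\beta(w)}$. A code $w_1\#\cdots\#w_p\#w_{p+1}$ is pure if $w_{p+1}=\varepsilon$ and each $w_i$ has non-increasing indices; $\pi$ is a bijection from pure codes $\mathsf{p}(\Sigma_{k\#}^\ast)$ onto $\Omega_k$, and $\mathsf{p}(y)$ denotes the unique pure code with $\pi(\mathsf{p}(y))=\pi(y)$. With a separator symbol $|$, $\mathrm{Confs}=\mathsf{p}(\Sigma_{k\#}^\ast)\cdot\{|\}\cdot\{\#\}^\ast$. Define $R_H=(R_0\cup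 R_1\cup R_2)\cap(\mathrm{Confs}\times\mathrm{Confs})$ where $R_0=\{(\#x|\#^n,\,x|\#^{n+1})\mid n\ge0,x\in\Sigma_{k\#}^\ast\}$, $R_1=\{(wa_0\#x|\#^n,\,w\#^n\mathsf{p}(a_0x)|\#^n)\mid n>1,w\in\Sigma_k^\ast,x\in\Sigma_{k\#}^\ast\}$, $R_2=\{(wa_i\#x|\#^n,\,wa_{i-1}^n\#\mathsf{p}(a_ix)|\#^n)\mid n>1,i>0,w\in\Sigma_k^\ast,x\in\Sigma_{k\#}^\ast\}$. $^\circledast$ denotes reflexive transitive closure (iterated composition). -}

module Defs where

open import Data.Nat using (ℕ; zero; suc; _≤_; _<_)
open import Data.Fin using (Fin; toℕ)
open import Data.List using (List; []; _∷_; _++_; _∷ʳ_; map; replicate)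
open import Data.Maybe using (Maybe; just; nothing)
open import Data.Product using (_×_; _,_)
open import Data.Empty using (⊥)
open import Data.Unit using (⊤)
open import Relation.Nullary using (¬_)
open import Relation.Binary.PropositionalEquality using (_≡_)
open import Relation.Binary.Construct.Closure.ReflexiveTransitive using (Star)
open import Relation.Binary.Construct.Closure.Symmetric using (SymClosure)

-- Ordinals below ε₀ in Cantor normal form:  ω^ a + b  stands for ω^a + b.

data Ord : Set where
  𝟘    : Ord
  ω^_+_ : Ord → Ord → Ord

data Cmp : Set where
  lt eq gt : Cmp

-- lexicographic comparison (correct on normal forms)
cmp : Ord → Ord → Cmp
cmp 𝟘 𝟘 = eq
cmp 𝟘 (ω^ _ + _) = lt
cmp (ω^ _ + _) 𝟘 = gt
cmp (ω^ a + α) (ω^ b + β) with cmp a b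
... | lt = lt
... | gt = gt
... | eq = cmp α β

NF : Ord → Set
NF 𝟘 = ⊤
NF (ω^ a + 𝟘) = NF a
NF (ω^ a + (ω^ b + β)) = NF a × NF (ω^ b + β) × ¬ (cmp a b ≡ lt)

infixl 6 _+o_
_+o_ : Ord → Ord → Ord
𝟘 +o β = β
(ω^ a + α) +o 𝟘 = ω^ a + α
(ω^ a + α) +o (ω^ b + β) with cmp a b
... | lt = ω^ b + β
... | _  = ω^ a + (α +o (ω^ b + β))

-- ω^b · γ  (left multiplication distributes over the CNF sum)
ω^_·_ : Ord → Ord → Ord
ω^ b · 𝟘 = 𝟘
ω^ b · (ω^ c + γ) = ω^ (b +o c) + (ω^ b · γ)

nat : ℕ → Ord
nat zero = 𝟘
nat (suc m) = ω^ 𝟘 + nat m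

Ωk : ℕ → Ord
Ωk k = ω^ (ω^ (nat k) + 𝟘) + 𝟘

InΩ : ℕ → Ord → Set
InΩ k α = NF α × cmp α (Ωk k) ≡ lt

pr : Ord → Maybe Ord
pr 𝟘 = nothing
pr (ω^ 𝟘 + 𝟘) = just 𝟘
pr (ω^ (ω^ _ + _) + 𝟘) = nothing
pr (ω^ a + (ω^ b + β)) with pr (ω^ b + β)
... | just p = just (ω^ a + p)
... | nothing = nothing

IsLim : Ord → Set
IsLim 𝟘 = ⊥
IsLim (ω^ 𝟘 + 𝟘) = ⊥
IsLim (ω^ (ω^ _ + _) + 𝟘) = ⊤
IsLim (ω^ a + (ω^ b + β)) = IsLim (ω^ b + β)

rep : ℕ → Ord → Ord
rep zero a = 𝟘
rep (suc n) a = ω^ a + rep n a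

fs : Ord → ℕ → Ord
fs 𝟘 n = 𝟘
fs (ω^ a + 𝟘) n with pr a
... | just a' = rep n a'
... | nothing = ω^ (fs a n) + 𝟘
fs (ω^ a + (ω^ b + β)) n = ω^ a + fs (ω^ b + β) n

-- graph of the Hardy hierarchy:  Hardy α n m  means  H^α(n) = m
data Hardy : Ord → ℕ → ℕ → Set where
  H-zero : ∀ {n} → Hardy 𝟘 n n
  H-suc  : ∀ {α β n m} → pr β ≡ just α → Hardy α (suc n) m → Hardy β n m
  H-lim  : ∀ {λ' n m} → IsLim λ' → Hardy (fs λ' n) n m → Hardy λ' n m

data Sym (k : ℕ) : Set where
  a : Fin k → Sym k
  # : Sym k

βw : {k : ℕ} → List (Fin k) → Ord
βw [] = 𝟘
βw (i ∷ w) = (ω^ (nat (toℕ i)) + 𝟘) +o βw w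

-- π(w) = 0 for w ∈ Σ_k*,  π(w#x) = ω^β(w)·π(x) + ω^β(w);
-- πacc w y computes π(w y) where w is the (Σ_k-)block read so far
πacc : {k : ℕ} → List (Fin k) → List (Sym k) → Ord
πacc w [] = 𝟘
πacc w (a i ∷ x) = πacc (w ∷ʳ i) x
πacc w (# ∷ x) = (ω^ (βw w) · πacc [] x) +o (ω^ (βw w) + 𝟘)

π : {k : ℕ} → List (Sym k) → Ord
π = πacc []

-- pure codes w₁#⋯#w_p# : each block has non-increasing indices and the
-- last block is empty.  PureB b y: b is the previous letter of the
-- current block (nothing if the current block is empty so far).
Ok : {k : ℕ} → Maybe (Fin k) → Fin k → Set
Ok nothing i = ⊤
Ok (just j) i = toℕ i ≤ toℕ j

data PureB {k : ℕ} : Maybe (Fin k) → List (Sym k) → Set where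
  end : PureB nothing []
  sep : ∀ {b x} → PureB nothing x → PureB b (# ∷ x)
  let′ : ∀ {b i x} → Ok b i → PureB (just i) x → PureB b (a i ∷ x)

Pure : {k : ℕ} → List (Sym k) → Set
Pure = PureB nothing

-- IsP y z : z is the pure code p(y), i.e. pure with π(z) = π(y)
IsP : {k : ℕ} → List (Sym k) → List (Sym k) → Set
IsP y z = Pure z × π z ≡ π y

-- Configurations  y | #^n  are represented as pairs (y , n), with y pure.

Conf : ℕ → Set
Conf k = List (Sym k) × ℕ

-- R_H = (R₀ ∪ R₁ ∪ R₂) ∩ (Confs × Confs)
data RH (k : ℕ) : Conf k → Conf k → Set where
  R0 : ∀ {x n} → Pure (# ∷ x) → Pure x →
       RH k (# ∷ x , n) (x , suc n)
  R1 : ∀ {w x z n} (i : Fin k) → toℕ i ≡ 0 → 1 < n →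
       IsP (a i ∷ x) z →
       Pure (map a w ++ a i ∷ # ∷ x) →
       Pure (map a w ++ replicate n # ++ z) →
       RH k (map a w ++ a i ∷ # ∷ x , n) (map a w ++ replicate n # ++ z , n)
  R2 : ∀ {w x z n} (i j : Fin k) → toℕ i ≡ suc (toℕ j) → 1 < n →
       IsP (a i ∷ x) z →
       Pure (map a w ++ a i ∷ # ∷ x) →
       Pure (map a w ++ replicate n (a j) ++ # ∷ z) →
       RH k (map a w ++ a i ∷ # ∷ x , n) (map a w ++ replicate n (a j) ++ # ∷ z , n)

RH⊛ : (k : ℕ) → Conf k → Conf k → Set
RH⊛ k = Star (SymClosure (RH k))

module Submission where

-- The proof has two halves.
--  * Soundness: every R_H step (y , n) → (y′ , n′) is one step of the Hardy
--    recursion read on codes: R₀ replaces π(y) = β+1 by β and n by n+1, while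
--    R₁ and R₂ replace the limit π(y) by its fundamental term π(y)_n.  Hence
--    both configurations of a step have the same Hardy value, and so do the
--    ends of any conversion.  Since H^α(n) is defined for every α in normal
--    form (ordinals below ε₀ in CNF are well founded and the fundamental
--    sequence of a limit lies below it), the Hardy values of the two ends of
--    a conversion exist and agree.
--  * Completeness: following a derivation of H^α(n) = m step by step yields an
--    R_H-reduction from π⁻¹(α)|#ⁿ to the final configuration ε|#^m; two such
--    reductions with the same m meet, which gives the conversion.

open import Defs
open import Data.Nat using (ℕ; zero; suc; _≤_; _<_; s≤s)
open import Data.Nat.Properties using (≤-refl; ≤-trans; <⇒≤; n≤1+n; m<n⇒m<1+n; _≤?_; ≰⇒>)
open import Data.Fin using (Fin; toℕ; inject₁) renaming (zero to fzero; suc to fsuc)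
open import Data.Fin.Properties using (toℕ-inject₁)
open import Data.List using (List; []; _∷_; _++_; _∷ʳ_; map; replicate)
open import Data.List.Properties using (++-assoc; ++-identityʳ; map-replicate)
open import Data.List.Relation.Unary.All using (All; []; _∷_) renaming (map to All-map)
open import Data.List.Relation.Unary.All.Properties using (∷ʳ⁺)
open import Data.Maybe using (Maybe; just; nothing)
import Data.Maybe as Maybe
open import Data.Maybe.Properties using (just-injective)
open import Data.Product using (Σ; _×_; _,_; proj₁; proj₂; ∃-syntax)
open import Data.Sum using (_⊎_; inj₁; inj₂)
open import Data.Empty using (⊥-elim)
open import Data.Unit using (⊤; tt)
open import Relation.Nullary using (¬_; yes; no)
open import Relation.Binary.PropositionalEquality
open import Relation.Binary.Construct.Closure.ReflexiveTransitive using (Star; ε; _◅_; _◅◅_)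
import Relation.Binary.Construct.Closure.ReflexiveTransitive as Star
open import Relation.Binary.Construct.Closure.Symmetric using (fwd; bwd; symmetric)
open import Induction.WellFounded using (Acc; acc)
open import Function.Bundles using (_⇔_; mk⇔; Equivalence)

cmp-refl : ∀ u → cmp u u ≡ eq
cmp-refl 𝟘 = refl
cmp-refl (ω^ u + α) rewrite cmp-refl u = cmp-refl α

cmp-eq : ∀ u v → cmp u v ≡ eq → u ≡ v
cmp-eq 𝟘 𝟘 _ = refl
cmp-eq (ω^ u + α) (ω^ v + β) h with cmp u v in e
... | eq = cong₂ ω^_+_ (cmp-eq u v e) (cmp-eq α β h)

flipC : Cmp → Cmp
flipC lt = gt
flipC eq = eq
flipC gt = lt

cmp-sym : ∀ u v → cmp v u ≡ flipC (cmp u v)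
cmp-sym 𝟘 𝟘 = refl
cmp-sym 𝟘 (ω^ _ + _) = refl
cmp-sym (ω^ _ + _) 𝟘 = refl
cmp-sym (ω^ u + α) (ω^ v + β) with cmp u v | cmp-sym u v
... | lt | p rewrite p = refl
... | gt | p rewrite p = refl
... | eq | p rewrite p = cmp-sym α β

-- The lexicographic order on CNF terms, as an inductive relation; it is the
-- relation decided by  cmp _ _ ≡ lt  and makes transitivity provable.
infix 4 _≺_
data _≺_ : Ord → Ord → Set where
  z≺ : ∀ {v β} → 𝟘 ≺ (ω^ v + β)
  h≺ : ∀ {u α v β} → u ≺ v → (ω^ u + α) ≺ (ω^ v + β)
  t≺ : ∀ {u α β} → α ≺ β → (ω^ u + α) ≺ (ω^ u + β)

≺⇒lt : ∀ {u v} → u ≺ v → cmp u v ≡ lt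
≺⇒lt z≺ = refl
≺⇒lt (h≺ p) rewrite ≺⇒lt p = refl
≺⇒lt (t≺ {u} p) rewrite cmp-refl u = ≺⇒lt p

lt⇒≺ : ∀ u v → cmp u v ≡ lt → u ≺ v
lt⇒≺ 𝟘 (ω^ _ + _) _ = z≺
lt⇒≺ (ω^ u + α) (ω^ v + β) h with cmp u v in e
... | lt = h≺ (lt⇒≺ u v e)
... | eq with cmp-eq u v e
...   | refl = t≺ (lt⇒≺ α β h)

≺-trans : ∀ {u v c} → u ≺ v → v ≺ c → u ≺ c
≺-trans z≺ (h≺ _) = z≺
≺-trans z≺ (t≺ _) = z≺
≺-trans (h≺ p) (h≺ q) = h≺ (≺-trans p q)
≺-trans (h≺ p) (t≺ q) = h≺ p
≺-trans (t≺ p) (h≺ q) = h≺ q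
≺-trans (t≺ p) (t≺ q) = t≺ (≺-trans p q)

≺-irrefl : ∀ {u} → ¬ (u ≺ u)
≺-irrefl {u} p with trans (sym (≺⇒lt p)) (cmp-refl u)
... | ()

infix 4 _≽_
_≽_ : Ord → Ord → Set
u ≽ v = ¬ (cmp u v ≡ lt)

≽-refl : ∀ u → u ≽ u
≽-refl u h = ≺-irrefl (lt⇒≺ u u h)

≽⇒≻⊎≡ : ∀ u v → u ≽ v → (v ≺ u) ⊎ (u ≡ v)
≽⇒≻⊎≡ u v h with cmp u v in e | cmp-sym u v
... | lt | _ = ⊥-elim (h refl)
... | eq | _ = inj₂ (cmp-eq u v e)
... | gt | s = inj₁ (lt⇒≺ v u s)

≻⊎≡⇒≽ : ∀ u v → (v ≺ u) ⊎ (u ≡ v) → u ≽ v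
≻⊎≡⇒≽ u v (inj₂ refl) = ≽-refl u
≻⊎≡⇒≽ u v (inj₁ p) h with trans (sym h) (trans (cmp-sym v u) (cong flipC (≺⇒lt p)))
... | ()

≽-trans : ∀ u v c → u ≽ v → v ≽ c → u ≽ c
≽-trans u v c p q = ≻⊎≡⇒≽ u c (combine (≽⇒≻⊎≡ u v p) (≽⇒≻⊎≡ v c q))
  where
  combine : (v ≺ u) ⊎ (u ≡ v) → (c ≺ v) ⊎ (v ≡ c) → (c ≺ u) ⊎ (u ≡ c)
  combine (inj₁ x) (inj₁ y) = inj₁ (≺-trans y x)
  combine (inj₁ x) (inj₂ refl) = inj₁ x
  combine (inj₂ refl) y = y

lt-trans : ∀ u v c → cmp u v ≡ lt → cmp v c ≡ lt → cmp u c ≡ lt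
lt-trans u v c p q = ≺⇒lt (≺-trans (lt⇒≺ u v p) (lt⇒≺ v c q))

lt? : (c : Cmp) → (c ≡ lt) ⊎ ¬ (c ≡ lt)
lt? lt = inj₁ refl
lt? eq = inj₂ (λ ())
lt? gt = inj₂ (λ ())

+o-lt : ∀ y z β γ → cmp y z ≡ lt → (ω^ y + β) +o (ω^ z + γ) ≡ ω^ z + γ
+o-lt y z β γ e rewrite e = refl

+o-≽ : ∀ y z β γ → y ≽ z → (ω^ y + β) +o (ω^ z + γ) ≡ ω^ y + (β +o (ω^ z + γ))
+o-≽ y z β γ h with cmp y z
... | lt = ⊥-elim (h refl)
... | eq = refl
... | gt = refl

+o-identityʳ : ∀ X → X +o 𝟘 ≡ X
+o-identityʳ 𝟘 = refl
+o-identityʳ (ω^ _ + _) = refl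

+o-assoc : ∀ u v c → (u +o v) +o c ≡ u +o (v +o c)
+o-assoc 𝟘 v c = refl
+o-assoc (ω^ x + α) 𝟘 c = refl
+o-assoc (ω^ x + α) (ω^ y + β) 𝟘 = +o-identityʳ _
+o-assoc (ω^ x + α) (ω^ y + β) (ω^ z + γ) with lt? (cmp x y) | lt? (cmp y z) | lt? (cmp x z)
... | inj₁ x<y | inj₁ y<z | _
  rewrite +o-lt x y α β x<y | +o-lt y z β γ y<z | +o-lt x z α γ (lt-trans x y z x<y y<z) = refl
... | inj₁ x<y | inj₂ y≽z | _
  rewrite +o-lt x y α β x<y | +o-≽ y z β γ y≽z | +o-lt x y α (β +o (ω^ z + γ)) x<y = refl
... | inj₂ x≽y | inj₁ y<z | inj₁ x<z
  rewrite +o-≽ x y α β x≽y | +o-lt y z β γ y<z | +o-lt x z (α +o (ω^ y + β)) γ x<z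
        | +o-lt x z α γ x<z = refl
... | inj₂ x≽y | inj₂ y≽z | inj₁ x<z = ⊥-elim (≽-trans x y z x≽y y≽z x<z)
... | inj₂ x≽y | inj₁ y<z | inj₂ x≽z
  rewrite +o-≽ x y α β x≽y | +o-lt y z β γ y<z | +o-≽ x z (α +o (ω^ y + β)) γ x≽z
        | +o-≽ x z α γ x≽z =
  cong (ω^ x +_) (trans (+o-assoc α (ω^ y + β) (ω^ z + γ)) (cong (α +o_) (+o-lt y z β γ y<z)))
... | inj₂ x≽y | inj₂ y≽z | inj₂ x≽z
  rewrite +o-≽ x y α β x≽y | +o-≽ y z β γ y≽z | +o-≽ x z (α +o (ω^ y + β)) γ x≽z
        | +o-≽ x y α (β +o (ω^ z + γ)) x≽y =
  cong (ω^ x +_) (trans (+o-assoc α (ω^ y + β) (ω^ z + γ)) (cong (α +o_) (+o-≽ y z β γ y≽z)))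

-- X ⊕ Y is the term whose summands are those of X followed by those of Y;
-- it is X + Y whenever no summand of X is absorbed, and it is the shape in
-- which codes and fundamental sequences are most easily computed.
infixr 5 _⊕_
_⊕_ : Ord → Ord → Ord
𝟘 ⊕ y = y
(ω^ u + α) ⊕ y = ω^ u + (α ⊕ y)

⊕-identityʳ : ∀ X → X ⊕ 𝟘 ≡ X
⊕-identityʳ 𝟘 = refl
⊕-identityʳ (ω^ u + α) = cong (ω^ u +_) (⊕-identityʳ α)

⊕-assoc : ∀ X Y Z → (X ⊕ Y) ⊕ Z ≡ X ⊕ (Y ⊕ Z)
⊕-assoc 𝟘 Y Z = refl
⊕-assoc (ω^ u + α) Y Z = cong (ω^ u +_) (⊕-assoc α Y Z)

⊕-nonzero : ∀ X v β → X ⊕ (ω^ v + β) ≢ 𝟘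
⊕-nonzero 𝟘 v β ()
⊕-nonzero (ω^ _ + _) v β ()

AllE : (Ord → Set) → Ord → Set
AllE P 𝟘 = ⊤
AllE P (ω^ u + α) = P u × AllE P α

AllE-+o : ∀ {P} X Y → AllE P X → AllE P Y → AllE P (X +o Y)
AllE-+o 𝟘 Y _ q = q
AllE-+o (ω^ x + α) 𝟘 p _ = p
AllE-+o (ω^ x + α) (ω^ y + β) (p1 , p2) q with lt? (cmp x y)
... | inj₁ e rewrite +o-lt x y α β e = q
... | inj₂ n rewrite +o-≽ x y α β n = p1 , AllE-+o α (ω^ y + β) p2 q

+o≡⊕ : ∀ X y β → AllE (_≽ y) X → X +o (ω^ y + β) ≡ X ⊕ (ω^ y + β)
+o≡⊕ 𝟘 y β _ = refl
+o≡⊕ (ω^ x + α) y β (p , q) = trans (+o-≽ x y α β p) (cong (ω^ x +_) (+o≡⊕ α y β q))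

+o-rep≡⊕ : ∀ X y n → AllE (_≽ y) X → X +o rep n y ≡ X ⊕ rep n y
+o-rep≡⊕ X y zero _ = trans (+o-identityʳ X) (sym (⊕-identityʳ X))
+o-rep≡⊕ X y (suc n) h = +o≡⊕ X y (rep n y) h

ω^+o≡ : ∀ c Y → AllE (c ≽_) Y → (ω^ c + 𝟘) +o Y ≡ ω^ c + Y
ω^+o≡ c 𝟘 _ = refl
ω^+o≡ c (ω^ e + Z) (p , _) = +o-≽ c e 𝟘 Z p

+o-≽ˡ : ∀ B c → (B +o c) ≽ B
+o-≽ˡ B 𝟘 rewrite +o-identityʳ B = ≽-refl B
+o-≽ˡ 𝟘 (ω^ _ + _) ()
+o-≽ˡ (ω^ x + α) (ω^ y + β) h with lt? (cmp x y)
... | inj₁ e rewrite +o-lt x y α β e | cmp-sym x y | e with h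
...   | ()
+o-≽ˡ (ω^ x + α) (ω^ y + β) h | inj₂ n rewrite +o-≽ x y α β n | cmp-refl x = +o-≽ˡ α (ω^ y + β) h

·-exponents : ∀ B P → AllE (_≽ B) (ω^ B · P)
·-exponents B 𝟘 = tt
·-exponents B (ω^ c + γ) = +o-≽ˡ B c , ·-exponents B γ

·-assoc : ∀ v c X → ω^ v · (ω^ c · X) ≡ ω^ (v +o c) · X
·-assoc v c 𝟘 = refl
·-assoc v c (ω^ d + Y) = cong₂ ω^_+_ (sym (+o-assoc v c d)) (·-assoc v c Y)

·-⊕ : ∀ v X Y → ω^ v · (X ⊕ Y) ≡ (ω^ v · X) ⊕ (ω^ v · Y)
·-⊕ v 𝟘 Y = refl
·-⊕ v (ω^ d + X) Y = cong (ω^ (v +o d) +_) (·-⊕ v X Y)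

·-identityˡ : ∀ X → ω^ 𝟘 · X ≡ X
·-identityˡ 𝟘 = refl
·-identityˡ (ω^ d + X) = cong (ω^ d +_) (·-identityˡ X)

·-rep : ∀ v m → ω^ v · rep m 𝟘 ≡ rep m v
·-rep v zero = refl
·-rep v (suc m) = cong₂ ω^_+_ (+o-identityʳ v) (·-rep v m)

rep-snoc : ∀ m v → rep m v ⊕ (ω^ v + 𝟘) ≡ ω^ v + rep m v
rep-snoc zero v = refl
rep-snoc (suc m) v = cong (ω^ v +_) (rep-snoc m v)

rep-absorb : ∀ m e f → cmp e f ≡ lt → rep m e +o (ω^ f + 𝟘) ≡ ω^ f + 𝟘
rep-absorb zero e f _ = refl
rep-absorb (suc m) e f h = +o-lt e f (rep m e) 𝟘 h

nat-< : ∀ i h → i < h → cmp (nat i) (nat h) ≡ lt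
nat-< zero (suc h) _ = refl
nat-< (suc i) (suc h) (s≤s p) = nat-< i h p

nat-≥ : ∀ i h → h ≤ i → nat i ≽ nat h
nat-≥ zero zero _ ()
nat-≥ (suc i) zero _ ()
nat-≥ (suc i) (suc h) (s≤s p) = nat-≥ i h p

pr-nat : ∀ j → pr (nat (suc j)) ≡ just (nat j)
pr-nat zero = refl
pr-nat (suc j) rewrite pr-nat j = refl

IsLim-cons : ∀ u v β → IsLim (ω^ v + β) → IsLim (ω^ u + (ω^ v + β))
IsLim-cons 𝟘 v β l = l
IsLim-cons (ω^ _ + _) v β l = l

IsLim-uncons : ∀ u v β → IsLim (ω^ u + (ω^ v + β)) → IsLim (ω^ v + β)
IsLim-uncons 𝟘 v β l = l
IsLim-uncons (ω^ _ + _) v β l = l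

pr-cons : ∀ u v β m → pr (ω^ v + β) ≡ m → pr (ω^ u + (ω^ v + β)) ≡ Maybe.map (ω^ u +_) m
pr-cons 𝟘 v β m refl with pr (ω^ v + β)
... | just _ = refl
... | nothing = refl
pr-cons (ω^ _ + _) v β m refl with pr (ω^ v + β)
... | just _ = refl
... | nothing = refl

IsLim⇒pr : ∀ α → IsLim α → pr α ≡ nothing
IsLim⇒pr (ω^ (ω^ _ + _) + 𝟘) _ = refl
IsLim⇒pr (ω^ u + (ω^ v + β)) l = pr-cons u v β _ (IsLim⇒pr (ω^ v + β) (IsLim-uncons u v β l))

IsLim-⊕ : ∀ X Y → IsLim Y → IsLim (X ⊕ Y)
IsLim-⊕ 𝟘 Y l = l
IsLim-⊕ (ω^ u + 𝟘) (ω^ v + β) l = IsLim-cons u v β l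
IsLim-⊕ (ω^ u + (ω^ c + X)) Y l = IsLim-cons u c _ (IsLim-⊕ (ω^ c + X) Y l)

¬IsLim-suc : ∀ X → ¬ IsLim (X ⊕ (ω^ 𝟘 + 𝟘))
¬IsLim-suc 𝟘 ()
¬IsLim-suc (ω^ u + 𝟘) l = IsLim-uncons u 𝟘 𝟘 l
¬IsLim-suc (ω^ u + (ω^ c + X)) l = ¬IsLim-suc (ω^ c + X) (IsLim-uncons u c _ l)

pr-suc : ∀ X → pr (X ⊕ (ω^ 𝟘 + 𝟘)) ≡ just X
pr-suc 𝟘 = refl
pr-suc (ω^ u + 𝟘) = pr-cons u 𝟘 𝟘 _ refl
pr-suc (ω^ u + (ω^ c + X)) = pr-cons u c _ _ (pr-suc (ω^ c + X))

pr-⊕-ω^lim : ∀ X d δ → pr (X ⊕ (ω^ (ω^ d + δ) + 𝟘)) ≡ nothing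
pr-⊕-ω^lim 𝟘 d δ = refl
pr-⊕-ω^lim (ω^ u + 𝟘) d δ = pr-cons u _ 𝟘 _ refl
pr-⊕-ω^lim (ω^ u + (ω^ c + X)) d δ = pr-cons u c _ _ (pr-⊕-ω^lim (ω^ c + X) d δ)

IsLim-ω^⊕ : ∀ X c → IsLim (ω^ (X ⊕ (ω^ c + 𝟘)) + 𝟘)
IsLim-ω^⊕ 𝟘 c = tt
IsLim-ω^⊕ (ω^ _ + _) c = tt

fs-⊕ : ∀ X v n → fs (X ⊕ (ω^ v + 𝟘)) n ≡ X ⊕ fs (ω^ v + 𝟘) n
fs-⊕ 𝟘 v n = refl
fs-⊕ (ω^ u + 𝟘) v n = refl
fs-⊕ (ω^ u + (ω^ c + X)) v n = cong (ω^ u +_) (fs-⊕ (ω^ c + X) v n)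

fs-ω^suc : ∀ v v′ n → pr v ≡ just v′ → fs (ω^ v + 𝟘) n ≡ rep n v′
fs-ω^suc v v′ n e with pr v
fs-ω^suc v v′ n refl | just .v′ = refl

fs-ω^lim : ∀ v n → pr v ≡ nothing → fs (ω^ v + 𝟘) n ≡ ω^ (fs v n) + 𝟘
fs-ω^lim v n e with pr v
fs-ω^lim v n refl | nothing = refl

-- Well-foundedness and totality of the Hardy hierarchy

HeadBelow : Ord → Ord → Set
HeadBelow u 𝟘 = ⊤
HeadBelow u (ω^ v + _) = u ≽ v

NF-head : ∀ u X → NF (ω^ u + X) → NF u
NF-head u 𝟘 n = n
NF-head u (ω^ _ + _) (n , _ , _) = n

NF-tail : ∀ u X → NF (ω^ u + X) → NF X
NF-tail u 𝟘 n = tt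
NF-tail u (ω^ _ + _) (_ , n , _) = n

NF-headBelow : ∀ u X → NF (ω^ u + X) → HeadBelow u X
NF-headBelow u 𝟘 n = tt
NF-headBelow u (ω^ _ + _) (_ , _ , l) = l

NF-cons : ∀ {u X} → NF u → NF X → HeadBelow u X → NF (ω^ u + X)
NF-cons {X = 𝟘} n _ _ = n
NF-cons {X = ω^ _ + _} n m l = n , m , l

HeadBelow-≺ : ∀ u p τ → HeadBelow u τ → p ≺ τ → HeadBelow u p
HeadBelow-≺ u 𝟘 τ l _ = tt
HeadBelow-≺ u (ω^ e + _) (ω^ v + _) l (h≺ e≺v) = ≽-trans u v e l (≻⊎≡⇒≽ v e (inj₁ e≺v))
HeadBelow-≺ u (ω^ e + _) (ω^ .e + _) l (t≺ _) = l

NF-≺tail : ∀ u X Y → NF (ω^ u + X) → NF Y → Y ≺ X → NF (ω^ u + Y)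
NF-≺tail u X Y nf nfY Y≺X =
  NF-cons (NF-head u X nf) nfY (HeadBelow-≺ u Y X (NF-headBelow u X nf) Y≺X)

_⊏_ : Ord → Ord → Set
x ⊏ y = NF x × (x ≺ y)

acc-𝟘 : Acc _⊏_ 𝟘
acc-𝟘 = acc λ { (_ , ()) }

tail-≺ : ∀ u v c d → NF (ω^ c + d) → c ≺ u → d ≺ (ω^ u + v)
tail-≺ u v c 𝟘 _ _ = z≺
tail-≺ u v c (ω^ e + f) nf c≺u with ≽⇒≻⊎≡ c e (NF-headBelow c (ω^ e + f) nf)
... | inj₁ e≺c = h≺ (≺-trans e≺c c≺u)
... | inj₂ refl = h≺ c≺u

acc-ω^+ : ∀ u → Acc _⊏_ u → ∀ v → Acc _⊏_ v → Acc _⊏_ (ω^ u + v)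
acc-ω^+ u (acc ru) v (acc rv) =
  acc λ {y} (nfy , y≺) →
    below u v (λ c⊏u → acc-ω^+ _ (ru c⊏u)) (λ d⊏v → acc-ω^+ u (acc ru) _ (rv d⊏v)) y nfy y≺
  where
  below : ∀ u v → (∀ {c} → c ⊏ u → ∀ d → Acc _⊏_ d → Acc _⊏_ (ω^ c + d)) →
          (∀ {d} → d ⊏ v → Acc _⊏_ (ω^ u + d)) →
          ∀ y → NF y → y ≺ (ω^ u + v) → Acc _⊏_ y
  below u v ih-head ih-tail 𝟘 _ _ = acc-𝟘
  below u v ih-head ih-tail (ω^ c + d) nf (h≺ c≺u) =
    ih-head (NF-head c d nf , c≺u) d
      (below u v ih-head ih-tail d (NF-tail c d nf) (tail-≺ u v c d nf c≺u))
  below u v ih-head ih-tail (ω^ .u + d) nf (t≺ d≺v) = ih-tail (NF-tail u d nf , d≺v)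

acc-NF : ∀ α → NF α → Acc _⊏_ α
acc-NF 𝟘 _ = acc-𝟘
acc-NF (ω^ u + v) nf = acc-ω^+ u (acc-NF u (NF-head u v nf)) v (acc-NF v (NF-tail u v nf))

pr-⊏ : ∀ α β → pr α ≡ just β → NF α → β ⊏ α
pr-⊏ (ω^ 𝟘 + 𝟘) .𝟘 refl _ = tt , z≺
pr-⊏ (ω^ u + (ω^ v + τ)) β e nf with pr (ω^ v + τ) in e′
... | nothing with () ← trans (sym e) (pr-cons u v τ _ e′)
... | just p with refl ← just-injective (trans (sym (pr-cons u v τ _ e′)) e) =
  NF-≺tail u _ p nf nfp p≺ , t≺ p≺
  where
  ih : p ⊏ (ω^ v + τ)
  ih = pr-⊏ (ω^ v + τ) p e′ (NF-tail u (ω^ v + τ) nf)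
  nfp = proj₁ ih
  p≺ = proj₂ ih

ord-cases : ∀ α → (α ≡ 𝟘) ⊎ ((Σ Ord λ β → pr α ≡ just β) ⊎ IsLim α)
ord-cases 𝟘 = inj₁ refl
ord-cases (ω^ 𝟘 + 𝟘) = inj₂ (inj₁ (𝟘 , refl))
ord-cases (ω^ (ω^ _ + _) + 𝟘) = inj₂ (inj₂ tt)
ord-cases (ω^ u + (ω^ v + β)) with ord-cases (ω^ v + β)
... | inj₂ (inj₁ (p , e)) = inj₂ (inj₁ (_ , pr-cons u v β _ e))
... | inj₂ (inj₂ l) = inj₂ (inj₂ (IsLim-cons u v β l))

IsLim-exponent : ∀ u → IsLim (ω^ u + 𝟘) → pr u ≡ nothing → IsLim u
IsLim-exponent u l e with ord-cases u
IsLim-exponent .𝟘 () e | inj₁ refl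
... | inj₂ (inj₁ (p , e′)) with () ← trans (sym e) e′
... | inj₂ (inj₂ l′) = l′

rep-NF : ∀ n c → NF c → NF (rep n c)
rep-NF zero c _ = tt
rep-NF (suc zero) c nf = nf
rep-NF (suc (suc n)) c nf = nf , rep-NF (suc n) c nf , ≽-refl c

fs-⊏ : ∀ α n → IsLim α → NF α → fs α n ⊏ α
fs-⊏ (ω^ u + 𝟘) n l nf = fs-ω^-⊏ u n l (λ lu → fs-⊏ u n lu) nf (pr u) refl
  where
  fs-ω^-⊏ : ∀ u n → IsLim (ω^ u + 𝟘) → (IsLim u → NF u → fs u n ⊏ u) →
            NF (ω^ u + 𝟘) → (m : Maybe Ord) → pr u ≡ m → fs (ω^ u + 𝟘) n ⊏ (ω^ u + 𝟘)
  fs-ω^-⊏ u n l ih nf (just u′) e rewrite fs-ω^suc u u′ n e =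
    rep-NF n u′ (proj₁ (pr-⊏ u u′ e nf)) , rep-≺ n
    where
    rep-≺ : ∀ n → rep n u′ ≺ (ω^ u + 𝟘)
    rep-≺ zero = z≺
    rep-≺ (suc n) = h≺ (proj₂ (pr-⊏ u u′ e nf))
  fs-ω^-⊏ u n l ih nf nothing e rewrite fs-ω^lim u n e =
    let (nfλ , λ≺u) = ih (IsLim-exponent u l e) nf in nfλ , h≺ λ≺u
fs-⊏ (ω^ u + (ω^ v + β)) n l nf =
  let (nfλ , λ≺) = fs-⊏ (ω^ v + β) n (IsLim-uncons u v β l) (NF-tail u (ω^ v + β) nf)
  in NF-≺tail u _ _ nf nfλ λ≺ , t≺ λ≺

hardy-total : ∀ α → NF α → ∀ n → ∃[ m ] Hardy α n m
hardy-total α nf = go α (acc-NF α nf) nf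
  where
  go : ∀ α → Acc _⊏_ α → NF α → ∀ n → ∃[ m ] Hardy α n m
  go α (acc r) nf n with ord-cases α
  ... | inj₁ refl = n , H-zero
  ... | inj₂ (inj₁ (β , e)) =
    let (nfβ , β≺α) = pr-⊏ α β e nf
        (m , h) = go β (r (nfβ , β≺α)) nfβ (suc n)
    in m , H-suc e h
  ... | inj₂ (inj₂ l) =
    let (nfλ , λ≺α) = fs-⊏ α n l nf
        (m , h) = go (fs α n) (r (nfλ , λ≺α)) nfλ n
    in m , H-lim l h

hardy-suc⁻¹ : ∀ {β n m} X → Hardy β n m → β ≡ X ⊕ (ω^ 𝟘 + 𝟘) → Hardy X (suc n) m
hardy-suc⁻¹ X H-zero e = ⊥-elim (⊕-nonzero X 𝟘 𝟘 (sym e))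
hardy-suc⁻¹ X (H-suc p h) refl with refl ← just-injective (trans (sym p) (pr-suc X)) = h
hardy-suc⁻¹ X (H-lim l h) refl = ⊥-elim (¬IsLim-suc X l)

hardy-lim⁻¹ : ∀ {β n m} → Hardy β n m → IsLim β → Hardy (fs β n) n m
hardy-lim⁻¹ (H-suc {β = β} p h) l with () ← trans (sym p) (IsLim⇒pr β l)
hardy-lim⁻¹ (H-lim _ h) l = h

module _ {k : ℕ} where

  natF : Fin k → Ord
  natF i = nat (toℕ i)

  mono : Ord → Ord
  mono c = ω^ c + 𝟘

  πacc-map : ∀ (pre w : List (Fin k)) (y : List (Sym k)) →
             πacc pre (map a w ++ y) ≡ πacc (pre ++ w) y
  πacc-map pre [] y = cong (λ l → πacc l y) (sym (++-identityʳ pre))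
  πacc-map pre (j ∷ w) y =
    trans (πacc-map (pre ∷ʳ j) w y) (cong (λ l → πacc l y) (++-assoc pre (j ∷ []) w))

  πacc-sep : ∀ (pre : List (Fin k)) (x : List (Sym k)) →
             πacc pre (# ∷ x) ≡ (ω^ βw pre · π x) ⊕ mono (βw pre)
  πacc-sep pre x = +o≡⊕ (ω^ βw pre · π x) (βw pre) 𝟘 (·-exponents (βw pre) (π x))

  π-# : (x : List (Sym k)) → π (# ∷ x) ≡ π x ⊕ mono 𝟘
  π-# x = trans (πacc-sep [] x) (cong (_⊕ mono 𝟘) (·-identityˡ (π x)))

  π-#^ : ∀ m (z : List (Sym k)) → π (replicate m # ++ z) ≡ π z ⊕ rep m 𝟘
  π-#^ zero z = sym (⊕-identityʳ (π z))
  π-#^ (suc m) z =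
    trans (π-# (replicate m # ++ z))
    (trans (cong (_⊕ mono 𝟘) (π-#^ m z))
    (trans (⊕-assoc (π z) (rep m 𝟘) (mono 𝟘)) (cong (π z ⊕_) (rep-snoc m 𝟘))))

  π-prefix : ∀ (i : Fin k) (pre : List (Fin k)) (x : List (Sym k)) →
             ω^ (mono (natF i)) · πacc pre x ≡ πacc (i ∷ pre) x
  π-prefix i pre [] = refl
  π-prefix i pre (a j ∷ x) = π-prefix i (pre ∷ʳ j) x
  π-prefix i pre (# ∷ x) = begin
      ω^ ωi · πacc pre (# ∷ x)
    ≡⟨ cong (ω^ ωi ·_) (πacc-sep pre x) ⟩
      ω^ ωi · ((ω^ βw pre · π x) ⊕ mono (βw pre))
    ≡⟨ ·-⊕ ωi (ω^ βw pre · π x) (mono (βw pre)) ⟩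
      (ω^ ωi · (ω^ βw pre · π x)) ⊕ mono (ωi +o βw pre)
    ≡⟨ cong (_⊕ mono (ωi +o βw pre)) (·-assoc ωi (βw pre) (π x)) ⟩
      (ω^ (ωi +o βw pre) · π x) ⊕ mono (ωi +o βw pre)
    ≡⟨ sym (πacc-sep (i ∷ pre) x) ⟩
      πacc (i ∷ pre) (# ∷ x)
    ∎
    where
    open ≡-Reasoning
    ωi = mono (natF i)

  βw-++ : ∀ (u v : List (Fin k)) → βw (u ++ v) ≡ βw u +o βw v
  βw-++ [] v = refl
  βw-++ (j ∷ u) v =
    trans (cong (mono (natF j) +o_) (βw-++ u v)) (sym (+o-assoc (mono (natF j)) (βw u) (βw v)))

  βw-replicate : ∀ n (j : Fin k) → βw (replicate n j) ≡ rep n (natF j)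
  βw-replicate zero j = refl
  βw-replicate (suc zero) j = refl
  βw-replicate (suc (suc n)) j =
    trans (cong (mono (natF j) +o_) (βw-replicate (suc n) j))
          (+o-≽ (natF j) (natF j) 𝟘 _ (≽-refl (natF j)))

  βw-AllE : ∀ (P : Ord → Set) (w : List (Fin k)) → All (λ j → P (natF j)) w → AllE P (βw w)
  βw-AllE P [] _ = tt
  βw-AllE P (j ∷ w) (p ∷ ps) = AllE-+o (mono (natF j)) (βw w) (p , tt) (βw-AllE P w ps)

  βw-≥ : ∀ (i : ℕ) (w : List (Fin k)) → All (λ j → i ≤ toℕ j) w → AllE (_≽ nat i) (βw w)
  βw-≥ i w ps = βw-AllE (_≽ nat i) w (All-map (λ {j} → nat-≥ (toℕ j) i) ps)

  βw-≤ : ∀ (h : Fin k) (r : List (Fin k)) → All (λ j → toℕ j ≤ toℕ h) r → AllE (natF h ≽_) (βw r)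
  βw-≤ h r ps = βw-AllE (natF h ≽_) r (All-map (λ {j} → nat-≥ (toℕ h) (toℕ j)) ps)

  head-≤ : ∀ {j i : Fin k} {y} (w : List (Fin k)) → PureB (just j) (map a w ++ a i ∷ y) → toℕ i ≤ toℕ j
  head-≤ [] (let′ ok _) = ok
  head-≤ (j′ ∷ w) (let′ ok q) = ≤-trans (head-≤ w q) ok

  block-≥ : ∀ {b} {i : Fin k} {y} (w : List (Fin k)) → PureB b (map a w ++ a i ∷ y) →
            All (λ j → toℕ i ≤ toℕ j) w
  block-≥ [] _ = []
  block-≥ (j ∷ w) (let′ _ q) = head-≤ w q ∷ block-≥ w q

  pure-rest : ∀ {b} {i : Fin k} {x} (w : List (Fin k)) → PureB b (map a w ++ a i ∷ # ∷ x) → Pure x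
  pure-rest [] (let′ _ (sep p)) = p
  pure-rest (j ∷ w) (let′ _ q) = pure-rest w q

  pure-#s : ∀ {t : List (Sym k)} m → Pure t → Pure (replicate m # ++ t)
  pure-#s zero p = p
  pure-#s (suc m) p = sep (pure-#s m p)

  pure-R1 : ∀ {b} {i : Fin k} {y t} (w : List (Fin k)) → PureB b (map a w ++ a i ∷ y) → Pure t →
            PureB b (map a w ++ # ∷ t)
  pure-R1 [] _ pt = sep pt
  pure-R1 (j ∷ w) (let′ ok q) pt = let′ ok (pure-R1 w q pt)

  Ok-≤ : ∀ {b} {i j : Fin k} → Ok b i → toℕ j ≤ toℕ i → Ok b j
  Ok-≤ {nothing} _ _ = tt
  Ok-≤ {just _} o le = ≤-trans le o

  pure-a^ : ∀ {b} {j : Fin k} {t} n → Ok b j → Pure t → PureB b (replicate n (a j) ++ # ∷ t)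
  pure-a^ zero _ pt = sep pt
  pure-a^ (suc n) o pt = let′ o (pure-a^ n ≤-refl pt)

  pure-R2 : ∀ {b} {i j : Fin k} {y t} n (w : List (Fin k)) → PureB b (map a w ++ a i ∷ y) →
            toℕ j ≤ toℕ i → Pure t → PureB b (map a w ++ replicate n (a j) ++ # ∷ t)
  pure-R2 n [] (let′ ok _) le pt = pure-a^ n (Ok-≤ ok le) pt
  pure-R2 n (j′ ∷ w) (let′ ok q) le pt = let′ ok (pure-R2 n w q le pt)

  redex : List (Fin k) → Fin k → List (Sym k) → List (Sym k)
  redex w i x = map a w ++ a i ∷ # ∷ x

  redex-split : ∀ {b} {i : Fin k} {y} → PureB b (a i ∷ y) →
                Σ (List (Fin k)) λ w → Σ (Fin k) λ i′ → Σ (List (Sym k)) λ x → a i ∷ y ≡ redex w i′ x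
  redex-split {y = []} (let′ _ ())
  redex-split {i = i} {y = # ∷ x} _ = [] , i , x , refl
  redex-split {i = i} {y = a j ∷ y} (let′ _ q) with redex-split q
  ... | w , i′ , x , e = i ∷ w , i′ , x , cong (a i ∷_) e

  βw-cons : ∀ (h : Fin k) r → All (λ j → toℕ j ≤ toℕ h) r → βw (h ∷ r) ≡ ω^ (natF h) + βw r
  βw-cons h r ps = ω^+o≡ (natF h) (βw r) (βw-≤ h r ps)

  -- A letter a_i in front of a block starting with a larger letter a_h is
  -- absorbed: ω^i + ω^h = ω^h.
  absorb : ∀ (i h : Fin k) (r : List (Fin k)) (y : List (Sym k)) (c : Fin k) → toℕ i < toℕ h →
           All (λ j → toℕ j ≤ toℕ h) r → PureB (just c) y → toℕ c ≤ toℕ h →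
           πacc (i ∷ h ∷ r) y ≡ πacc (h ∷ r) y
  absorb i h r [] c _ _ _ _ = refl
  absorb i h r (a c′ ∷ y) c i<h ps (let′ le q) ch =
    absorb i h (r ∷ʳ c′) y c′ i<h (∷ʳ⁺ ps (≤-trans le ch)) q (≤-trans le ch)
  absorb i h r (# ∷ y) c i<h ps _ _ = cong (λ β → (ω^ β · π y) +o mono β) βw-absorb
    where
    βw-absorb : βw (i ∷ h ∷ r) ≡ βw (h ∷ r)
    βw-absorb = trans (cong (mono (natF i) +o_) (βw-cons h r ps))
                (trans (+o-lt (natF i) (natF h) 𝟘 (βw r) (nat-< (toℕ i) (toℕ h) i<h))
                       (sym (βw-cons h r ps)))

  -- p(a_i x) exists for pure x: keep a_i unless the next letter is larger.
  normalise : ∀ (i : Fin k) (x : List (Sym k)) → Pure x → Σ (List (Sym k)) λ z → IsP (a i ∷ x) z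
  normalise i [] _ = [] , end , refl
  normalise i (# ∷ x) (sep p) = a i ∷ # ∷ x , let′ tt (sep p) , refl
  normalise i (a h ∷ x) (let′ _ q) with toℕ h ≤? toℕ i
  ... | yes h≤i = a i ∷ a h ∷ x , let′ tt (let′ h≤i q) , refl
  ... | no h≰i = a h ∷ x , let′ tt q , sym (absorb i h [] x h (≰⇒> h≰i) [] q ≤-refl)

  -- β(w a_i): the exponent of the last summand of π(w a_i # x).
  βredex : List (Fin k) → Fin k → Ord
  βredex w i = βw w +o mono (natF i)

  π-redex : ∀ w i x → π (redex w i x) ≡ (ω^ βredex w i · π x) ⊕ mono (βredex w i)
  π-redex w i x =
    trans (πacc-map [] w (a i ∷ # ∷ x))
    (trans (πacc-sep (w ∷ʳ i) x) (cong (λ β → (ω^ β · π x) ⊕ mono β) (βw-++ w (i ∷ []))))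

  βredex-⊕ : ∀ w i → All (λ j → toℕ i ≤ toℕ j) w → βredex w i ≡ βw w ⊕ mono (natF i)
  βredex-⊕ w i ps = +o≡⊕ (βw w) (natF i) 𝟘 (βw-≥ (toℕ i) w ps)

  redex-IsLim : ∀ w i x → All (λ j → toℕ i ≤ toℕ j) w → IsLim (π (redex w i x))
  redex-IsLim w i x ps = subst IsLim (sym (π-redex w i x))
    (IsLim-⊕ (ω^ βredex w i · π x) (mono (βredex w i))
      (subst (λ β → IsLim (mono β)) (sym (βredex-⊕ w i ps)) (IsLim-ω^⊕ (βw w) (natF i))))

  fs-redex : ∀ w i x n → fs (π (redex w i x)) n ≡ (ω^ βredex w i · π x) ⊕ fs (mono (βredex w i)) n
  fs-redex w i x n = trans (cong (λ β → fs β n) (π-redex w i x)) (fs-⊕ (ω^ βredex w i · π x) (βredex w i) n)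

  -- Moving a_i from the end of the block into the next code: ω^β(w)·π(p(a_i x)) = ω^β(w a_i)·π(x).
  π-normalised : ∀ w i x (z : List (Sym k)) → π z ≡ π (a i ∷ x) →
                 ω^ βw w · π z ≡ ω^ βredex w i · π x
  π-normalised w i x z ez =
    trans (cong (ω^ βw w ·_) (trans ez (sym (π-prefix i [] x)))) (·-assoc (βw w) (mono (natF i)) (π x))

  fs-last-R1 : ∀ w i n → toℕ i ≡ 0 → All (λ j → toℕ i ≤ toℕ j) w →
               fs (mono (βredex w i)) n ≡ rep n (βw w)
  fs-last-R1 w i n i0 ps = fs-ω^suc (βredex w i) (βw w) n
    (trans (cong pr (trans (βredex-⊕ w i ps) (cong (λ c → βw w ⊕ mono (nat c)) i0))) (pr-suc (βw w)))

  fs-R1 : ∀ w i x (z : List (Sym k)) n → toℕ i ≡ 0 → All (λ j → toℕ i ≤ toℕ j) w →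
          π z ≡ π (a i ∷ x) → fs (π (redex w i x)) (suc n) ≡ π (map a w ++ replicate (suc n) # ++ z)
  fs-R1 w i x z n i0 ps ez = begin
      fs (π (redex w i x)) (suc n)
    ≡⟨ fs-redex w i x (suc n) ⟩
      (ω^ βredex w i · π x) ⊕ fs (mono (βredex w i)) (suc n)
    ≡⟨ cong₂ _⊕_ (sym (π-normalised w i x z ez)) (fs-last-R1 w i (suc n) i0 ps) ⟩
      (ω^ βw w · π z) ⊕ rep (suc n) (βw w)
    ≡⟨ cong ((ω^ βw w · π z) ⊕_) (sym (rep-snoc n (βw w))) ⟩
      (ω^ βw w · π z) ⊕ (rep n (βw w) ⊕ mono (βw w))
    ≡⟨ sym (⊕-assoc (ω^ βw w · π z) (rep n (βw w)) (mono (βw w))) ⟩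
      ((ω^ βw w · π z) ⊕ rep n (βw w)) ⊕ mono (βw w)
    ≡⟨ cong (λ t → ((ω^ βw w · π z) ⊕ t) ⊕ mono (βw w)) (sym (·-rep (βw w) n)) ⟩
      ((ω^ βw w · π z) ⊕ (ω^ βw w · rep n 𝟘)) ⊕ mono (βw w)
    ≡⟨ cong (_⊕ mono (βw w)) (sym (·-⊕ (βw w) (π z) (rep n 𝟘))) ⟩
      (ω^ βw w · (π z ⊕ rep n 𝟘)) ⊕ mono (βw w)
    ≡⟨ cong (λ t → (ω^ βw w · t) ⊕ mono (βw w)) (sym (π-#^ n z)) ⟩
      (ω^ βw w · π (replicate n # ++ z)) ⊕ mono (βw w)
    ≡⟨ sym (πacc-sep w (replicate n # ++ z)) ⟩
      πacc w (# ∷ (replicate n # ++ z))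
    ≡⟨ sym (πacc-map [] w (# ∷ (replicate n # ++ z))) ⟩
      π (map a w ++ replicate (suc n) # ++ z)
    ∎
    where open ≡-Reasoning

  fs-last-R2 : ∀ w i j n → toℕ i ≡ suc (toℕ j) → All (λ l → toℕ i ≤ toℕ l) w →
               fs (mono (βredex w i)) n ≡ mono (βw w +o rep n (natF j))
  fs-last-R2 w i j n ij ps = begin
      fs (mono (βredex w i)) n
    ≡⟨ fs-ω^lim (βredex w i) n (trans (cong pr βi) (pr-⊕-ω^lim (βw w) 𝟘 (natF j))) ⟩
      mono (fs (βredex w i) n)
    ≡⟨ cong (λ β → mono (fs β n)) βi ⟩
      mono (fs (βw w ⊕ mono (ω^ 𝟘 + natF j)) n)
    ≡⟨ cong mono (fs-⊕ (βw w) (ω^ 𝟘 + natF j) n) ⟩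
      mono (βw w ⊕ fs (mono (ω^ 𝟘 + natF j)) n)
    ≡⟨ cong (λ t → mono (βw w ⊕ t)) (fs-ω^suc (ω^ 𝟘 + natF j) (natF j) n (pr-nat (toℕ j))) ⟩
      mono (βw w ⊕ rep n (natF j))
    ≡⟨ cong mono (sym (+o-rep≡⊕ (βw w) (natF j) n (βw-≥ (toℕ j) w ps-j))) ⟩
      mono (βw w +o rep n (natF j))
    ∎
    where
    open ≡-Reasoning
    βi : βredex w i ≡ βw w ⊕ mono (ω^ 𝟘 + natF j)
    βi = trans (βredex-⊕ w i ps) (cong (λ c → βw w ⊕ mono (nat c)) ij)
    ps-j : All (λ l → toℕ j ≤ toℕ l) w
    ps-j = All-map (λ {l} p → <⇒≤ (subst (_≤ toℕ l) ij p)) ps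

  -- ω^(β(w)+ω^j·n)·π(p(a_i x)) = ω^β(w a_i)·π(x), since ω^j·n + ω^i = ω^i.
  π-normalised-R2 : ∀ w i j x (z : List (Sym k)) n → toℕ i ≡ suc (toℕ j) → π z ≡ π (a i ∷ x) →
                    ω^ (βw w +o rep n (natF j)) · π z ≡ ω^ βredex w i · π x
  π-normalised-R2 w i j x z n ij ez = begin
      ω^ C · π z
    ≡⟨ cong (ω^ C ·_) (trans ez (sym (π-prefix i [] x))) ⟩
      ω^ C · (ω^ mono (natF i) · π x)
    ≡⟨ ·-assoc C (mono (natF i)) (π x) ⟩
      ω^ (C +o mono (natF i)) · π x
    ≡⟨ cong (λ c → ω^ c · π x) (+o-assoc (βw w) (rep n (natF j)) (mono (natF i))) ⟩
      ω^ (βw w +o (rep n (natF j) +o mono (natF i))) · π x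
    ≡⟨ cong (λ c → ω^ (βw w +o c) · π x) (rep-absorb n (natF j) (natF i) j<i) ⟩
      ω^ βredex w i · π x
    ∎
    where
    open ≡-Reasoning
    C = βw w +o rep n (natF j)
    j<i : cmp (natF j) (natF i) ≡ lt
    j<i = nat-< (toℕ j) (toℕ i) (subst (suc (toℕ j) ≤_) (sym ij) ≤-refl)

  fs-R2 : ∀ w i j x (z : List (Sym k)) n → toℕ i ≡ suc (toℕ j) → All (λ l → toℕ i ≤ toℕ l) w →
          π z ≡ π (a i ∷ x) → fs (π (redex w i x)) n ≡ π (map a w ++ replicate n (a j) ++ # ∷ z)
  fs-R2 w i j x z n ij ps ez = begin
      fs (π (redex w i x)) n
    ≡⟨ fs-redex w i x n ⟩
      (ω^ βredex w i · π x) ⊕ fs (mono (βredex w i)) n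
    ≡⟨ cong₂ _⊕_ (sym (π-normalised-R2 w i j x z n ij ez)) (fs-last-R2 w i j n ij ps) ⟩
      (ω^ C · π z) ⊕ mono C
    ≡⟨ cong (λ c → (ω^ c · π z) ⊕ mono c) (sym βw-wj) ⟩
      (ω^ βw (w ++ replicate n j) · π z) ⊕ mono (βw (w ++ replicate n j))
    ≡⟨ sym (πacc-sep (w ++ replicate n j) z) ⟩
      πacc (w ++ replicate n j) (# ∷ z)
    ≡⟨ sym (πacc-map w (replicate n j) (# ∷ z)) ⟩
      πacc w (map a (replicate n j) ++ # ∷ z)
    ≡⟨ cong (λ l → πacc w (l ++ # ∷ z)) (map-replicate a n j) ⟩
      πacc w (replicate n (a j) ++ # ∷ z)
    ≡⟨ sym (πacc-map [] w (replicate n (a j) ++ # ∷ z)) ⟩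
      π (map a w ++ replicate n (a j) ++ # ∷ z)
    ∎
    where
    open ≡-Reasoning
    C = βw w +o rep n (natF j)
    βw-wj : βw (w ++ replicate n j) ≡ C
    βw-wj = trans (βw-++ w (replicate n j)) (cong (βw w +o_) (βw-replicate n j))

  -- Soundness: R_H steps preserve Hardy values

  HardyConf : Conf k → ℕ → Set
  HardyConf (y , n) m = Hardy (π y) n m

  limit-step : ∀ {β β′ n m} → IsLim β → fs β n ≡ β′ → Hardy β n m ⇔ Hardy β′ n m
  limit-step {n = n} {m} lim e =
    mk⇔ (λ h → subst (λ γ → Hardy γ n m) e (hardy-lim⁻¹ h lim))
        (λ h → H-lim lim (subst (λ γ → Hardy γ n m) (sym e) h))

  -- R₀ is a successor step, R₁ and R₂ are limit steps.
  step-sound : ∀ {c c′ : Conf k} → RH k c c′ → ∀ m → HardyConf c m ⇔ HardyConf c′ m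
  step-sound (R0 {x} {n} _ _) m =
    mk⇔ (λ h → hardy-suc⁻¹ (π x) h (π-# x))
        (λ h → subst (λ β → Hardy β n m) (sym (π-# x)) (H-suc (pr-suc (π x)) h))
  step-sound (R1 {w} {x} {z} {suc n} i i0 _ (_ , ez) pL _) m =
    limit-step (redex-IsLim w i x (block-≥ w pL)) (fs-R1 w i x z n i0 (block-≥ w pL) ez)
  step-sound (R2 {w} {x} {z} {n} i j ij _ (_ , ez) pL _) m =
    limit-step (redex-IsLim w i x (block-≥ w pL)) (fs-R2 w i j x z n ij (block-≥ w pL) ez)

  conversion-sound : ∀ {c c′ : Conf k} → RH⊛ k c c′ → ∀ m → HardyConf c m → HardyConf c′ m
  conversion-sound ε m h = h
  conversion-sound (fwd r ◅ rs) m h = conversion-sound rs m (Equivalence.to (step-sound r m) h)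
  conversion-sound (bwd r ◅ rs) m h = conversion-sound rs m (Equivalence.from (step-sound r m) h)

  -- Completeness: the computation of H^α(n) is an R_H-reduction

  redex-step : ∀ {n m} w i x → Pure (redex w i x) → 1 < n →
               (∀ y′ → Pure y′ → π y′ ≡ fs (π (redex w i x)) n → Star (RH k) (y′ , n) ([] , m)) →
               Star (RH k) (redex w i x , n) ([] , m)
  redex-step {suc n} w fzero x pL n>1 continue with normalise fzero x (pure-rest w pL)
  ... | z , pz , ez =
    R1 fzero refl n>1 (pz , ez) pL pR ◅
    continue _ pR (sym (fs-R1 w fzero x z n refl (block-≥ w pL) ez))
    where
    pR = pure-R1 w pL (pure-#s n pz)
  redex-step {n} w (fsuc j) x pL n>1 continue with normalise (fsuc j) x (pure-rest w pL)
  ... | z , pz , ez =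
    R2 (fsuc j) (inject₁ j) ij n>1 (pz , ez) pL pR ◅
    continue _ pR (sym (fs-R2 w (fsuc j) (inject₁ j) x z n ij (block-≥ w pL) ez))
    where
    ij : toℕ (fsuc j) ≡ suc (toℕ (inject₁ j))
    ij = cong suc (sym (toℕ-inject₁ j))
    pR = pure-R2 n w pL (subst (_≤ suc (toℕ j)) (sym (toℕ-inject₁ j)) (n≤1+n _)) pz

  letter-IsLim : ∀ (i : Fin k) x → Pure (a i ∷ x) → IsLim (π (a i ∷ x))
  letter-IsLim i x p with redex-split p
  ... | w , i′ , x′ , e =
    subst (λ l → IsLim (π l)) (sym e) (redex-IsLim w i′ x′ (block-≥ w (subst Pure e p)))

  letter-nonzero : ∀ (i : Fin k) x → Pure (a i ∷ x) → π (a i ∷ x) ≢ 𝟘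
  letter-nonzero i x p e0 with redex-split p
  ... | w , i′ , x′ , e =
    ⊕-nonzero (ω^ βredex w i′ · π x′) (βredex w i′) 𝟘
      (trans (sym (π-redex w i′ x′)) (trans (cong π (sym e)) e0))

  -- By induction on the derivation of H^α(n) = m: the zero case is the empty
  -- code, successors are R₀ steps, limits are R₁/R₂ steps.
  hardy-reduces : ∀ {α n m} → Hardy α n m → ∀ y → Pure y → π y ≡ α → 1 < n →
                  Star (RH k) (y , n) ([] , m)
  hardy-reduces H-zero [] _ _ _ = ε
  hardy-reduces H-zero (# ∷ x) _ e _ = ⊥-elim (⊕-nonzero (π x) 𝟘 𝟘 (trans (sym (π-# x)) e))
  hardy-reduces H-zero (a i ∷ x) p e _ = ⊥-elim (letter-nonzero i x p e)
  hardy-reduces (H-suc () h) [] _ refl _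
  hardy-reduces (H-suc q h) (# ∷ x) (sep px) refl n>1
    with refl ← just-injective (trans (sym (pr-suc (π x))) (trans (cong pr (sym (π-# x))) q)) =
    R0 (sep px) px ◅ hardy-reduces h x px refl (m<n⇒m<1+n n>1)
  hardy-reduces (H-suc q h) (a i ∷ x) p refl _
    with () ← trans (sym q) (IsLim⇒pr (π (a i ∷ x)) (letter-IsLim i x p))
  hardy-reduces (H-lim () h) [] _ refl _
  hardy-reduces (H-lim l h) (# ∷ x) _ refl _ = ⊥-elim (¬IsLim-suc (π x) (subst IsLim (π-# x) l))
  hardy-reduces {n = n} {m} (H-lim l h) (a i ∷ x) p refl n>1 with redex-split p
  ... | w , i′ , x′ , e =
    subst (λ l′ → Star (RH k) (l′ , n) ([] , m)) (sym e)
      (redex-step w i′ x′ (subst Pure e p) n>1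
        (λ y′ py′ ey′ → hardy-reduces h y′ py′ (trans ey′ (cong (λ l′ → fs (π l′) n) (sym e))) n>1))

lemma4 : (k : ℕ) (α α′ : Ord) → InΩ k α → InΩ k α′ →
         (w w′ : List (Sym k)) → Pure w → π w ≡ α → Pure w′ → π w′ ≡ α′ →
         (n n′ : ℕ) → 1 < n → 1 < n′ →
         RH⊛ k (w , n) (w′ , n′) ⇔ (∃[ m ] (Hardy α n m × Hardy α′ n′ m))
lemma4 k α α′ (nf , _) _ w w′ pw refl pw′ refl n n′ n>1 n′>1 = mk⇔ to from
  where
  to : RH⊛ k (w , n) (w′ , n′) → ∃[ m ] (Hardy α n m × Hardy α′ n′ m)
  to conv with hardy-total α nf n
  ... | m , h = m , h , conversion-sound conv m h
  from : ∃[ m ] (Hardy α n m × Hardy α′ n′ m) → RH⊛ k (w , n) (w′ , n′)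
  from (m , h , h′) =
    Star.map fwd (hardy-reduces h w pw refl n>1) ◅◅
    Star.reverse (symmetric (RH k)) (Star.map fwd (hardy-reduces h′ w′ pw′ refl n′>1))
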